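{- Let $A\subseteq\omega$ be $m$-rigid. Then for all integers $k\ge 1$, $A_{(k)}<_1 A_{(k+1)}$, i.e. $A_{(k)}\le_1 A_{(k+1)}$ and $A_{(k+1)}\not\le_1 A_{(k)}$, where $A_{(j)}=\{x\in\omega:\lfloor x/j\rfloor\in A\}$.
   Context: A set $A\subseteq\omega$ is $m$-rigid if for every total computable $f:\omega\to\omega$ such that $x\in A\iff f(x)\in A$ for all $x$, we have $f(x)=x$ for all but finitely many $x$. $A\le_1 B$ means there is an injective total computable $f$ with $x\in A\iff f(x)\in B$ for all $x$. -}

module Defs where

open import Level using (0ℓ)
open import Data.Nat using (ℕ; zero; suc; _<_; _≤_; _/_; NonZero)
open import Data.Fin using (Fin)
open import Data.Vec using (Vec; []; _∷_; lookup)
open import Data.Product using (Σ; _×_; ∃)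
open import Relation.Binary.PropositionalEquality using (_≡_)
open import Relation.Nullary using (¬_)
open import Function.Definitions using (Injective)

data Code : ℕ → Set where
  zer  : ∀ {n} → Code n
  succ : Code 1
  proj : ∀ {n} → Fin n → Code n
  comp : ∀ {n m} → Code m → Vec (Code n) m → Code n
  prec : ∀ {n} → Code n → Code (suc (suc n)) → Code (suc n)
  mu   : ∀ {n} → Code (suc n) → Code n

mutual
  data Eval : ∀ {n} → Code n → Vec ℕ n → ℕ → Set where
    e-zer  : ∀ {n} {xs : Vec ℕ n} → Eval zer xs 0
    e-succ : ∀ {x} → Eval succ (x ∷ []) (suc x)
    e-proj : ∀ {n} {i : Fin n} {xs} → Eval (proj i) xs (lookup xs i)
    e-comp : ∀ {n m} {f : Code m} {gs : Vec (Code n) m} {xs ys y} →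
             EvalAll gs xs ys → Eval f ys y → Eval (comp f gs) xs y
    e-prec-z : ∀ {n} {g : Code n} {h} {xs y} →
             Eval g xs y → Eval (prec g h) (0 ∷ xs) y
    e-prec-s : ∀ {n} {g : Code n} {h} {k xs r y} →
             Eval (prec g h) (k ∷ xs) r → Eval h (k ∷ r ∷ xs) y →
             Eval (prec g h) (suc k ∷ xs) y
    e-mu   : ∀ {n} {f : Code (suc n)} {xs y} →
             Eval f (y ∷ xs) 0 →
             (∀ z → z < y → Σ ℕ (λ v → Eval f (z ∷ xs) (suc v))) →
             Eval (mu f) xs y

  data EvalAll : ∀ {n m} → Vec (Code n) m → Vec ℕ n → Vec ℕ m → Set where
    ea-[] : ∀ {n} {xs : Vec ℕ n} → EvalAll [] xs []
    ea-∷  : ∀ {n m} {g : Code n} {gs : Vec (Code n) m} {xs y ys} →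
            Eval g xs y → EvalAll gs xs ys → EvalAll (g ∷ gs) xs (y ∷ ys)

Computable : (ℕ → ℕ) → Set
Computable f = Σ (Code 1) (λ c → ∀ x → Eval c (x ∷ []) (f x))

Subset : Set₁
Subset = ℕ → Set

Reduces : (ℕ → ℕ) → Subset → Subset → Set
Reduces f A B = ∀ x → (A x → B (f x)) × (B (f x) → A x)

_≤₁_ : Subset → Subset → Set
A ≤₁ B = Σ (ℕ → ℕ) (λ f → Computable f × Injective _≡_ _≡_ f × Reduces f A B)

MRigid : Subset → Set
MRigid A = ∀ f → Computable f → Reduces f A A → ∃ (λ N → ∀ x → N ≤ x → f x ≡ x)

Cyl : Subset → (j : ℕ) → .{{NonZero j}} → Subset
Cyl A j x = A (x / j)

-- The map x ↦ x + ⌊x/k⌋ sends the k-block of x onto k of the k+1 points of the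
-- corresponding (k+1)-block, which gives A_(k) ≤₁ A_(k+1). Conversely, let g reduce
-- A_(k+1) to A_(k) injectively. For each of the k+1 positions i of a (k+1)-block,
-- x ↦ ⌊g(i + x(k+1))/k⌋ is a computable self-reduction of A, so by rigidity all of
-- them are eventually the identity. Then g maps the k+1 points of some (k+1)-block
-- injectively into a single k-block, which the pigeonhole principle forbids.
module Submission where

open import Defs
open import Data.Nat
open import Data.Nat.Properties
open import Data.Nat.DivMod
open import Data.Nat.Divisibility using (divides-refl)
open import Data.Fin using (Fin; zero; suc; toℕ; fromℕ<)
open import Data.Fin.Properties using (toℕ<n; toℕ-injective; fromℕ<-injective; injective⇒≤)
open import Data.Vec using (Vec; []; _∷_)
open import Data.Product using (Σ; ∃; _×_; _,_; proj₁; proj₂)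
open import Function using (_∘_; id)
open import Function.Definitions using (Injective)
import Function.Construct.Composition as Composition
open import Relation.Binary.PropositionalEquality
open import Relation.Nullary using (¬_)

private variable
  n : ℕ

m<[1+m/n]*n : ∀ m n .{{_ : NonZero n}} → m < suc (m / n) * n
m<[1+m/n]*n m n = begin-strict
    m                   ≡⟨ m≡m%n+[m/n]*n m n ⟩
    m % n + (m / n) * n <⟨ +-monoˡ-< ((m / n) * n) (m%n<n m n) ⟩
    n + (m / n) * n     ∎
  where open ≤-Reasoning

m<n⇒[m+o*n]/n≡o : ∀ {m} o n .{{_ : NonZero n}} → m < n → (m + o * n) / n ≡ o
m<n⇒[m+o*n]/n≡o {m} o n m<n = begin
    (m + o * n) / n     ≡⟨ +-distrib-/-∣ʳ m (divides-refl o) ⟩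
    m / n + o * n / n   ≡⟨ cong₂ _+_ (m<n⇒m/n≡0 m<n) (m*n/n≡m o n) ⟩
    o                   ∎
  where open ≡-Reasoning

/-%-injective : ∀ {x y} n .{{_ : NonZero n}} → x / n ≡ y / n → x % n ≡ y % n → x ≡ y
/-%-injective {x} {y} n x/n≡y/n x%n≡y%n = begin
    x                   ≡⟨ m≡m%n+[m/n]*n x n ⟩
    x % n + (x / n) * n ≡⟨ cong₂ (λ r q → r + q * n) x%n≡y%n x/n≡y/n ⟩
    y % n + (y / n) * n ≡⟨ m≡m%n+[m/n]*n y n ⟨
    y                   ∎
  where open ≡-Reasoning

block-pigeonhole : ∀ {m} k .{{_ : NonZero k}} {q} (h : Fin m → ℕ) → Injective _≡_ _≡_ h →
                   (∀ i → h i / k ≡ q) → m ≤ k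
block-pigeonhole k h h-injective inBlock = injective⇒≤ remainder-injective
  where
  remainder : Fin _ → Fin k
  remainder i = fromℕ< (m%n<n (h i) k)
  remainder-injective : Injective _≡_ _≡_ remainder
  remainder-injective {i} {j} eq = h-injective (/-%-injective k
    (trans (inBlock i) (sym (inBlock j)))
    (fromℕ<-injective _ _ (m%n<n (h i) k) (m%n<n (h j) k) eq))

slot : Fin n → ℕ → ℕ
slot {n} i q = toℕ i + q * n

slot-/ : .{{_ : NonZero n}} → ∀ (i : Fin n) q → slot i q / n ≡ q
slot-/ {n} i q = m<n⇒[m+o*n]/n≡o q n (toℕ<n i)

slot-injectiveˡ : ∀ q → Injective _≡_ _≡_ (λ (i : Fin n) → slot i q)
slot-injectiveˡ {n} q {i} {j} eq = toℕ-injective (+-cancelʳ-≡ (q * n) (toℕ i) (toℕ j) eq)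

Eventually : (ℕ → Set) → Set
Eventually P = ∃ λ N → ∀ x → N ≤ x → P x

eventually-∀Fin : {P : Fin n → ℕ → Set} →
                  (∀ i → Eventually (P i)) → Eventually (λ x → ∀ i → P i x)
eventually-∀Fin {zero}  _  = 0 , λ _ _ ()
eventually-∀Fin {suc n} ev with ev zero | eventually-∀Fin (ev ∘ suc)
... | N₀ , p₀ | N , p = N₀ ⊔ N , λ
  { x le zero    → p₀ x (≤-trans (m≤m⊔n N₀ N) le)
  ; x le (suc i) → p x (≤-trans (m≤n⊔m N₀ N) le) i }

preimage-reduces : ∀ (A : Subset) p q f → (∀ x → p (f x) ≡ q x) →
                   Reduces f (A ∘ q) (A ∘ p)
preimage-reduces A p q f pf≡q x = subst A (sym (pf≡q x)) , subst A (pf≡q x)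

comp₁ : Code 1 → Code n → Code n
comp₁ f g = comp f (g ∷ [])

comp₂ : Code 2 → Code n → Code n → Code n
comp₂ f g h = comp f (g ∷ h ∷ [])

eval-comp₁ : ∀ {f g} {xs : Vec ℕ n} {a b} →
             Eval g xs a → Eval f (a ∷ []) b → Eval (comp₁ f g) xs b
eval-comp₁ eg ef = e-comp (ea-∷ eg ea-[]) ef

eval-comp₂ : ∀ {f g h} {xs : Vec ℕ n} {a b c} →
             Eval g xs a → Eval h xs b → Eval f (a ∷ b ∷ []) c → Eval (comp₂ f g h) xs c
eval-comp₂ eg eh ef = e-comp (ea-∷ eg (ea-∷ eh ea-[])) ef

addConst : ℕ → Code n → Code n
addConst zero    c = c
addConst (suc j) c = comp₁ succ (addConst j c)

eval-addConst : ∀ j {c} {xs : Vec ℕ n} {a} → Eval c xs a → Eval (addConst j c) xs (j + a)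
eval-addConst zero    e = e
eval-addConst (suc j) e = eval-comp₁ (eval-addConst j e) e-succ

mulConst : ℕ → Code 1
mulConst k = prec zer (addConst k (proj (suc zero)))

eval-mulConst : ∀ k y → Eval (mulConst k) (y ∷ []) (y * k)
eval-mulConst k zero    = e-prec-z e-zer
eval-mulConst k (suc y) = e-prec-s (eval-mulConst k y) (eval-addConst k e-proj)

predᶜ : Code 1
predᶜ = prec zer (proj zero)

eval-pred : ∀ x → Eval predᶜ (x ∷ []) (pred x)
eval-pred zero    = e-prec-z e-zer
eval-pred (suc x) = e-prec-s (eval-pred x) e-proj

-- Primitive recursion runs on the first argument, so monus takes the subtrahend first.
monus : Code 2
monus = prec (proj zero) (comp₁ predᶜ (proj (suc zero)))

eval-monus : ∀ y x → Eval monus (y ∷ x ∷ []) (x ∸ y)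
eval-monus zero    x = e-prec-z e-proj
eval-monus (suc y) x = subst (Eval monus (suc y ∷ x ∷ [])) (pred[m∸n]≡m∸[1+n] x y)
  (e-prec-s (eval-monus y x) (eval-comp₁ e-proj (eval-pred (x ∸ y))))

plus : Code 2
plus = prec (proj zero) (comp₁ succ (proj (suc zero)))

eval-plus : ∀ a b → Eval plus (a ∷ b ∷ []) (a + b)
eval-plus zero    b = e-prec-z e-proj
eval-plus (suc a) b = e-prec-s (eval-plus a b) (eval-comp₁ e-proj e-succ)

-- (y , x) ↦ (1 + x) ∸ (1 + y) * k vanishes exactly when x / k ≤ y, so its least root is x / k.
divRoot : ℕ → Code 2
divRoot k = comp₂ monus (comp₁ (mulConst k) (comp₁ succ (proj zero))) (comp₁ succ (proj (suc zero)))

eval-divRoot : ∀ k y x → Eval (divRoot k) (y ∷ x ∷ []) (suc x ∸ suc y * k)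
eval-divRoot k y x = eval-comp₂ (eval-comp₁ (eval-comp₁ e-proj e-succ) (eval-mulConst k (suc y)))
                                (eval-comp₁ e-proj e-succ) (eval-monus _ _)

divConst : ℕ → Code 1
divConst k = mu (divRoot k)

eval-positive : ∀ {c : Code n} {xs y} → Eval c xs y → 0 < y → Σ ℕ λ v → Eval c xs (suc v)
eval-positive e (s≤s z≤n) = _ , e

eval-divConst : ∀ k .{{_ : NonZero k}} x → Eval (divConst k) (x ∷ []) (x / k)
eval-divConst k x = e-mu root below
  where
  root : Eval (divRoot k) (x / k ∷ x ∷ []) 0
  root = subst (Eval (divRoot k) _) (m≤n⇒m∸n≡0 (m<[1+m/n]*n x k)) (eval-divRoot k (x / k) x)
  below : ∀ z → z < x / k → Σ ℕ λ v → Eval (divRoot k) (z ∷ x ∷ []) (suc v)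
  below z z<x/k = eval-positive (eval-divRoot k z x)
    (m<n⇒0<n∸m (s≤s (≤-trans (*-monoˡ-≤ k z<x/k) (m/n*n≤m x k))))

computable-id : Computable id
computable-id = proj zero , λ _ → e-proj

computable-∘ : ∀ {f g} → Computable f → Computable g → Computable (f ∘ g)
computable-∘ (c , ev-c) (d , ev-d) = comp₁ c d , λ x → eval-comp₁ (ev-d x) (ev-c _)

computable-+ : ∀ {f g} → Computable f → Computable g → Computable (λ x → f x + g x)
computable-+ (c , ev-c) (d , ev-d) = comp₂ plus c d , λ x → eval-comp₂ (ev-c x) (ev-d x) (eval-plus _ _)

computable-+ˡ : ∀ j → Computable (j +_)
computable-+ˡ j = addConst j (proj zero) , λ _ → eval-addConst j e-proj

computable-*ʳ : ∀ k → Computable (_* k)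
computable-*ʳ k = mulConst k , eval-mulConst k

computable-/ : ∀ k .{{_ : NonZero k}} → Computable (_/ k)
computable-/ k = divConst k , eval-divConst k

computable-slot : ∀ (i : Fin n) → Computable (slot i)
computable-slot {n} i = computable-∘ (computable-+ˡ (toℕ i)) (computable-*ʳ n)

-- x + x / k is the (x % k)-th point of the (x / k)-th block of length k + 1.
[m+m/n]/[1+n]≡m/n : ∀ m n .{{_ : NonZero n}} → (m + m / n) / suc n ≡ m / n
[m+m/n]/[1+n]≡m/n m n = begin
    (m + q) / suc n                 ≡⟨ cong (λ t → (t + q) / suc n) (m≡m%n+[m/n]*n m n) ⟩
    (m % n + q * n + q) / suc n     ≡⟨ cong (_/ suc n) (+-assoc (m % n) (q * n) q) ⟩
    (m % n + (q * n + q)) / suc n   ≡⟨ cong (λ t → (m % n + t) / suc n) q*n+q≡q*[1+n] ⟩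
    (m % n + q * suc n) / suc n     ≡⟨ m<n⇒[m+o*n]/n≡o q (suc n) (m<n⇒m<1+n (m%n<n m n)) ⟩
    q                               ∎
  where
  open ≡-Reasoning
  q = m / n
  q*n+q≡q*[1+n] : q * n + q ≡ q * suc n
  q*n+q≡q*[1+n] = trans (+-comm (q * n) q) (sym (*-suc q n))

Cyl-≤₁-Cyl-suc : ∀ A k .{{_ : NonZero k}} → Cyl A k ≤₁ Cyl A (suc k)
Cyl-≤₁-Cyl-suc A k = spread , computable-+ computable-id (computable-/ k) , spread-injective
                   , preimage-reduces A (_/ suc k) (_/ k) spread (λ x → [m+m/n]/[1+n]≡m/n x k)
  where
  spread : ℕ → ℕ
  spread x = x + x / k
  spread-injective : Injective _≡_ _≡_ spread
  spread-injective {x} {y} eq = +-cancelʳ-≡ (x / k) x y (trans eq (cong (y +_) (sym x/k≡y/k)))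
    where
    x/k≡y/k : x / k ≡ y / k
    x/k≡y/k = trans (sym ([m+m/n]/[1+n]≡m/n x k))
                    (trans (cong (_/ suc k) eq) ([m+m/n]/[1+n]≡m/n y k))

Cyl-suc-≰₁-Cyl : ∀ A → MRigid A → ∀ k .{{_ : NonZero k}} → ¬ (Cyl A (suc k) ≤₁ Cyl A k)
Cyl-suc-≰₁-Cyl A rigid k (g , g-computable , g-injective , g-reduces) =
  1+n≰n (block-pigeonhole k (λ i → g (slot i M))
          (Composition.injective _≡_ _≡_ _≡_ (slot-injectiveˡ M) g-injective)
          (proj₂ fixed M ≤-refl))
  where
  pull : Fin (suc k) → ℕ → ℕ
  pull i = (_/ k) ∘ g ∘ slot i
  pull-computable : ∀ i → Computable (pull i)
  pull-computable i = computable-∘ (computable-/ k) (computable-∘ g-computable (computable-slot i))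
  pull-reduces : ∀ i → Reduces (pull i) A A
  pull-reduces i x = proj₁ (g-reduces (slot i x)) ∘ subst A (sym (slot-/ i x))
                   , subst A (slot-/ i x) ∘ proj₂ (g-reduces (slot i x))
  fixed : Eventually (λ x → ∀ i → pull i x ≡ x)
  fixed = eventually-∀Fin λ i → rigid (pull i) (pull-computable i) (pull-reduces i)
  M : ℕ
  M = proj₁ fixed

theorem4p3 : (A : Subset) → MRigid A → (k : ℕ) → .{{_ : NonZero k}} →
    (Cyl A k ≤₁ Cyl A (suc k)) × ¬ (Cyl A (suc k) ≤₁ Cyl A k)
theorem4p3 A rigid k = Cyl-≤₁-Cyl-suc A k , Cyl-suc-≰₁-Cyl A rigid k
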